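{- Let $\mathsf{C}$ be a category, $Q:\mathsf{C}\to\mathsf{Pos}$ a functor, $n,m\ge 0$, and $F:(\mathsf{C}^{op})^{n}\times\mathsf{C}^{m}\to\mathsf{C}$ a functor. There is a bijection between liftings of $F$ to $\int Q$ (functors $\overline{F}:((\int Q)^{op})^{n}\times(\int Q)^{m}\to\int Q$ with $\pi\circ\overline{F}=F\circ(\pi^{n}\times\pi^{m})$ strictly) and lax extranatural transformations $\psi:\prod Q^{n+m}\to Q\circ F$.
   Context: $\mathsf{Pos}$ is the category of posets and monotone maps. The total (Grothendieck) category $\int Q$ has as objects pairs $(X,x)$ with $X$ an object of $\mathsf{C}$ and $x\in Q(X)$, and as arrows $f:(X,x)\to(Y,y)$ the arrows $f:X\to Y$ of $\mathsf{C}$ with $Q(f)(x)\le y$; $\pi:\int Q\to\mathsf{C}$ is the projection $(X,x)\mapsto X$, $f\mapsto f$. For $X=(X_1,\dots,X_k)$ write $Q(X)=\prod_i Q(X_i)$ and $Q(f)=\prod_i Q(f_i)$ for $f=(f_1,\dots,f_k)$. A lax extranatural transformation $\psi:\prod Q^{n+m}\to Q\circ F$ is a family of monotone maps $\psi_{X,Y}:\prod_{i}Q(X_i)^{op}\times\prod_j Q(Y_j)\to Q(F(X,Y))$, indexed by objects $X$ of $\mathsf{C}^n$ and $Y$ of $\mathsf{C}^m$, such that for all arrows $f:X\to X'$ in $\mathsf{C}^n$, $g:Y\to Y'$ in $\mathsf{C}^m$ and all $x\in Q(X)$, $y\in Q(Y)$: $Q(F(f,g))\big(\psi_{X',Y}(Q(f)(x),y)\big)\le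 \psi_{X,Y'}\big(x,Q(g)(y)\big)$ (here $F(f,g):F(X',Y)\to F(X,Y')$). -}

module Defs where

open import Level using (Level; _⊔_; Lift; lift) renaming (suc to lsuc; zero to lzero)
open import Data.Nat using (ℕ; zero; suc)
open import Data.Unit.Polymorphic using (⊤; tt)
open import Data.Product using (Σ; _×_; _,_; proj₁; proj₂)
open import Relation.Binary using (Rel; IsEquivalence; IsPartialOrder; IsPreorder)
open import Relation.Binary.PropositionalEquality
  using (_≡_; refl; sym; trans; cong; cong₂; subst; subst₂)

record Category (o ℓ e : Level) : Set (lsuc (o ⊔ ℓ ⊔ e)) where
  infixr 9 _∘_
  infix  4 _≈_
  field
    Obj       : Set o
    _⇒_       : Obj → Obj → Set ℓ
    _≈_       : ∀ {A B} → Rel (A ⇒ B) e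
    id        : ∀ {A} → A ⇒ A
    _∘_       : ∀ {A B C} → B ⇒ C → A ⇒ B → A ⇒ C
    assoc     : ∀ {A B C D} {f : A ⇒ B} {g : B ⇒ C} {h : C ⇒ D} →
                (h ∘ g) ∘ f ≈ h ∘ (g ∘ f)
    identityˡ : ∀ {A B} {f : A ⇒ B} → id ∘ f ≈ f
    identityʳ : ∀ {A B} {f : A ⇒ B} → f ∘ id ≈ f
    equiv     : ∀ {A B} → IsEquivalence (_≈_ {A} {B})
    ∘-resp-≈  : ∀ {A B C} {f h : B ⇒ C} {g i : A ⇒ B} →
                f ≈ h → g ≈ i → f ∘ g ≈ h ∘ i

record Functor {o ℓ e o′ ℓ′ e′} (C : Category o ℓ e) (D : Category o′ ℓ′ e′)
       : Set (o ⊔ ℓ ⊔ e ⊔ o′ ⊔ ℓ′ ⊔ e′) where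
  private
    module C = Category C
    module D = Category D
  field
    F₀           : C.Obj → D.Obj
    F₁           : ∀ {A B} → A C.⇒ B → F₀ A D.⇒ F₀ B
    identity     : ∀ {A} → F₁ (C.id {A}) D.≈ D.id
    homomorphism : ∀ {X Y Z} {f : X C.⇒ Y} {g : Y C.⇒ Z} →
                   F₁ (g C.∘ f) D.≈ F₁ g D.∘ F₁ f
    F-resp-≈     : ∀ {A B} {f g : A C.⇒ B} → f C.≈ g → F₁ f D.≈ F₁ g

open Functor public

_∘F_ : ∀ {o ℓ e o′ ℓ′ e′ o″ ℓ″ e″}
         {C : Category o ℓ e} {D : Category o′ ℓ′ e′} {E : Category o″ ℓ″ e″} →
       Functor D E → Functor C D → Functor C E
_∘F_ {C = C} {D} {E} G H = record
  { F₀ = λ A → F₀ G (F₀ H A)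
  ; F₁ = λ f → F₁ G (F₁ H f)
  ; identity = EEq.trans (F-resp-≈ G (identity H)) (identity G)
  ; homomorphism = EEq.trans (F-resp-≈ G (homomorphism H)) (homomorphism G)
  ; F-resp-≈ = λ p → F-resp-≈ G (F-resp-≈ H p)
  }
  where module E = Category E
        module EEq {A} {B} = IsEquivalence (E.equiv {A} {B})

record StrictEq {o ℓ e o′ ℓ′ e′} {C : Category o ℓ e} {D : Category o′ ℓ′ e′}
       (G H : Functor C D) : Set (o ⊔ ℓ ⊔ o′ ⊔ ℓ′ ⊔ e′) where
  private
    module C = Category C
    module D = Category D
  field
    eq₀ : ∀ A → F₀ G A ≡ F₀ H A
    eq₁ : ∀ {A B} (f : A C.⇒ B) →
          subst₂ D._⇒_ (eq₀ A) (eq₀ B) (F₁ G f) D.≈ F₁ H f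

op : ∀ {o ℓ e} → Category o ℓ e → Category o ℓ e
op C = record
  { Obj = Obj ; _⇒_ = λ A B → B ⇒ A ; _≈_ = _≈_ ; id = id
  ; _∘_ = λ f g → g ∘ f
  ; assoc = Eq.sym assoc ; identityˡ = identityʳ ; identityʳ = identityˡ
  ; equiv = equiv ; ∘-resp-≈ = λ p q → ∘-resp-≈ q p }
  where open Category C
        module Eq {A} {B} = IsEquivalence (equiv {A} {B})

Product : ∀ {o ℓ e o′ ℓ′ e′} → Category o ℓ e → Category o′ ℓ′ e′ →
          Category (o ⊔ o′) (ℓ ⊔ ℓ′) (e ⊔ e′)
Product C D = record
  { Obj = C.Obj × D.Obj
  ; _⇒_ = λ A B → (proj₁ A C.⇒ proj₁ B) × (proj₂ A D.⇒ proj₂ B)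
  ; _≈_ = λ f g → (proj₁ f C.≈ proj₁ g) × (proj₂ f D.≈ proj₂ g)
  ; id = C.id , D.id
  ; _∘_ = λ f g → (proj₁ f C.∘ proj₁ g) , (proj₂ f D.∘ proj₂ g)
  ; assoc = C.assoc , D.assoc
  ; identityˡ = C.identityˡ , D.identityˡ
  ; identityʳ = C.identityʳ , D.identityʳ
  ; equiv = record
      { refl = CE.refl , DE.refl
      ; sym = λ p → CE.sym (proj₁ p) , DE.sym (proj₂ p)
      ; trans = λ p q → CE.trans (proj₁ p) (proj₁ q) , DE.trans (proj₂ p) (proj₂ q) }
  ; ∘-resp-≈ = λ p q → C.∘-resp-≈ (proj₁ p) (proj₁ q) , D.∘-resp-≈ (proj₂ p) (proj₂ q)
  }
  where module C = Category C
        module D = Category D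
        module CE {A} {B} = IsEquivalence (C.equiv {A} {B})
        module DE {A} {B} = IsEquivalence (D.equiv {A} {B})

One : ∀ {o ℓ e} → Category o ℓ e
One = record
  { Obj = ⊤ ; _⇒_ = λ _ _ → ⊤ ; _≈_ = λ _ _ → ⊤ ; id = tt ; _∘_ = λ _ _ → tt
  ; assoc = tt ; identityˡ = tt ; identityʳ = tt
  ; equiv = record { refl = tt ; sym = λ _ → tt ; trans = λ _ _ → tt }
  ; ∘-resp-≈ = λ _ _ → tt }

Pow : ∀ {o ℓ e} → Category o ℓ e → ℕ → Category o ℓ e
Pow C zero    = One
Pow C (suc n) = Product C (Pow C n)

opF : ∀ {o ℓ e o′ ℓ′ e′} {C : Category o ℓ e} {D : Category o′ ℓ′ e′} →
      Functor C D → Functor (op C) (op D)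
opF G = record
  { F₀ = F₀ G ; F₁ = F₁ G ; identity = identity G
  ; homomorphism = homomorphism G ; F-resp-≈ = F-resp-≈ G }

_⁂_ : ∀ {o₁ ℓ₁ e₁ o₂ ℓ₂ e₂ o₃ ℓ₃ e₃ o₄ ℓ₄ e₄}
        {A : Category o₁ ℓ₁ e₁} {B : Category o₂ ℓ₂ e₂}
        {C : Category o₃ ℓ₃ e₃} {D : Category o₄ ℓ₄ e₄} →
      Functor A B → Functor C D → Functor (Product A C) (Product B D)
G ⁂ H = record
  { F₀ = λ X → F₀ G (proj₁ X) , F₀ H (proj₂ X)
  ; F₁ = λ f → F₁ G (proj₁ f) , F₁ H (proj₂ f)
  ; identity = identity G , identity H
  ; homomorphism = homomorphism G , homomorphism H
  ; F-resp-≈ = λ p → F-resp-≈ G (proj₁ p) , F-resp-≈ H (proj₂ p) }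

PowF : ∀ {o ℓ e o′ ℓ′ e′} {C : Category o ℓ e} {D : Category o′ ℓ′ e′} →
       Functor C D → (n : ℕ) → Functor (Pow C n) (Pow D n)
PowF G zero = record
  { F₀ = λ _ → tt ; F₁ = λ _ → tt ; identity = tt
  ; homomorphism = tt ; F-resp-≈ = λ _ → tt }
PowF G (suc n) = G ⁂ PowF G n

record PosetObj (p r : Level) : Set (lsuc (p ⊔ r)) where
  field
    Carrier        : Set p
    _≤_            : Carrier → Carrier → Set r
    isPartialOrder : IsPartialOrder _≡_ _≤_

record Monotone {p r} (P Q : PosetObj p r) : Set (p ⊔ r) where
  private
    module P = PosetObj P
    module Q = PosetObj Q
  field
    fun  : P.Carrier → Q.Carrier
    mono : ∀ {x y} → x P.≤ y → fun x Q.≤ fun y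

open Monotone public

Pos : ∀ p r → Category (lsuc (p ⊔ r)) (p ⊔ r) p
Pos p r = record
  { Obj = PosetObj p r
  ; _⇒_ = Monotone
  ; _≈_ = λ f g → ∀ x → fun f x ≡ fun g x
  ; id = record { fun = λ x → x ; mono = λ q → q }
  ; _∘_ = λ f g → record { fun = λ x → fun f (fun g x) ; mono = λ q → mono f (mono g q) }
  ; assoc = λ _ → refl ; identityˡ = λ _ → refl ; identityʳ = λ _ → refl
  ; equiv = record { refl = λ _ → refl ; sym = λ q x → sym (q x)
                   ; trans = λ q s x → trans (q x) (s x) }
  ; ∘-resp-≈ = λ {_} {_} {_} {f} {h} {g} {i} q s x →
      trans (cong (fun f) (s x)) (q (fun i x))
  }

module _ {o ℓ e p r} (C : Category o ℓ e) (Q : Functor C (Pos p r)) where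
  private
    module C = Category C
    module CE {A} {B} = IsEquivalence (C.equiv {A} {B})

  Q₀ : C.Obj → Set p
  Q₀ X = PosetObj.Carrier (F₀ Q X)
  Q≤ : ∀ {X} → Q₀ X → Q₀ X → Set r
  Q≤ {X} = PosetObj._≤_ (F₀ Q X)

  private
    module QP X = IsPartialOrder (PosetObj.isPartialOrder (F₀ Q X))

  ∫ : Category (o ⊔ p) (ℓ ⊔ r) e
  ∫ = record
    { Obj = Σ C.Obj Q₀
    ; _⇒_ = λ A B → Σ (proj₁ A C.⇒ proj₁ B)
                      (λ f → Q≤ (fun (F₁ Q f) (proj₂ A)) (proj₂ B))
    ; _≈_ = λ f g → proj₁ f C.≈ proj₁ g
    ; id = λ {A} → C.id , QP.reflexive (proj₁ A) (identity Q {proj₁ A} (proj₂ A))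
    ; _∘_ = λ {A} {B} {D} g f →
        (proj₁ g C.∘ proj₁ f) ,
        QP.trans (proj₁ D)
          (QP.reflexive (proj₁ D) (homomorphism Q {f = proj₁ f} {g = proj₁ g} (proj₂ A)))
          (QP.trans (proj₁ D) (mono (F₁ Q (proj₁ g)) (proj₂ f)) (proj₂ g))
    ; assoc = C.assoc ; identityˡ = C.identityˡ ; identityʳ = C.identityʳ
    ; equiv = record { refl = CE.refl ; sym = CE.sym ; trans = CE.trans }
    ; ∘-resp-≈ = C.∘-resp-≈
    }

  π : Functor ∫ C
  π = record
    { F₀ = proj₁ ; F₁ = proj₁ ; identity = CE.refl
    ; homomorphism = CE.refl ; F-resp-≈ = λ q → q }

  -- Q(X) = ∏ᵢ Q(Xᵢ) with the product order, and Q(f) = ∏ᵢ Q(fᵢ)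
  QT : (k : ℕ) → Category.Obj (Pow C k) → Set p
  QT zero    _        = ⊤
  QT (suc k) (X , Xs) = Q₀ X × QT k Xs

  ≤T : (k : ℕ) (X : Category.Obj (Pow C k)) → QT k X → QT k X → Set r
  ≤T zero    _        _        _        = ⊤
  ≤T (suc k) (X , Xs) (x , xs) (y , ys) = Q≤ {X} x y × ≤T k Xs xs ys

  QT₁ : (k : ℕ) {X Y : Category.Obj (Pow C k)} → Category._⇒_ (Pow C k) X Y →
        QT k X → QT k Y
  QT₁ zero    _        _        = tt
  QT₁ (suc k) (f , fs) (x , xs) = fun (F₁ Q f) x , QT₁ k fs xs

module _ {o ℓ e p r} (C : Category o ℓ e) (Q : Functor C (Pos p r)) (n m : ℕ)
         (F : Functor (Product (op (Pow C n)) (Pow C m)) C) where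
  private
    module C = Category C

  record Lifting : Set (o ⊔ ℓ ⊔ e ⊔ p ⊔ r) where
    field
      F̄      : Functor (Product (op (Pow (∫ C Q) n)) (Pow (∫ C Q) m)) (∫ C Q)
      strict : StrictEq (π C Q ∘F F̄) (F ∘F (opF (PowF (π C Q) n) ⁂ PowF (π C Q) m))

  LiftingEq : Lifting → Lifting → Set (o ⊔ ℓ ⊔ e ⊔ p ⊔ r)
  LiftingEq L L′ = StrictEq (Lifting.F̄ L) (Lifting.F̄ L′)

  record LaxExtranat : Set (o ⊔ ℓ ⊔ p ⊔ r) where
    field
      ψ    : (X : Category.Obj (Pow C n)) (Y : Category.Obj (Pow C m)) →
             QT C Q n X → QT C Q m Y → PosetObj.Carrier (F₀ Q (F₀ F (X , Y)))
      mono : ∀ {X Y} {x x′ : QT C Q n X} {y y′ : QT C Q m Y} →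
             ≤T C Q n X x′ x → ≤T C Q m Y y y′ →
             PosetObj._≤_ (F₀ Q (F₀ F (X , Y))) (ψ X Y x y) (ψ X Y x′ y′)
      lax  : ∀ {X X′ Y Y′} (f : Category._⇒_ (Pow C n) X X′)
               (g : Category._⇒_ (Pow C m) Y Y′) (x : QT C Q n X) (y : QT C Q m Y) →
             PosetObj._≤_ (F₀ Q (F₀ F (X , Y′)))
               (fun (F₁ Q (F₁ F {X′ , Y} {X , Y′} (f , g))) (ψ X′ Y (QT₁ C Q n f x) y))
               (ψ X Y′ x (QT₁ C Q m g y))

  LaxEq : LaxExtranat → LaxExtranat → Set (o ⊔ p)
  LaxEq φ φ′ = ∀ X Y x y → LaxExtranat.ψ φ X Y x y ≡ LaxExtranat.ψ φ′ X Y x y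

record Bijection {a b ℓa ℓb} (A : Set a) (_≈A_ : A → A → Set ℓa)
                 (B : Set b) (_≈B_ : B → B → Set ℓb)
                 : Set (a ⊔ b ⊔ ℓa ⊔ ℓb) where
  field
    to          : A → B
    from        : B → A
    to-cong     : ∀ {x y} → x ≈A y → to x ≈B to y
    from-cong   : ∀ {x y} → x ≈B y → from x ≈A from y
    to∘from     : ∀ y → to (from y) ≈B y
    from∘to     : ∀ x → from (to x) ≈A x

{-# OPTIONS --safe #-}
-- A lifting F̄ is determined by the second components of its values: since π ∘ F̄ = G
-- strictly, F̄ amounts to elements s_A of Q(G A) with Q(G h)(s_A) ≤ s_B for every arrow h,
-- a lax section of Q along G; this holds for any functor G into C.
-- For G = F ∘ (π^n × π^m), an object of (∫Q)^k is a tuple X with some x in Q(X), and an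
-- arrow is an f with Q(f)(x) ≤ x′. So a lax section along G is a family ψ with
-- Q(F(f,g))(ψ_{X′,Y}(x′,y)) ≤ ψ_{X,Y′}(x,y′) whenever Q(f)(x) ≤ x′ and Q(g)(y) ≤ y′,
-- which splits into monotonicity of each ψ_{X,Y} (f, g identities) and lax
-- extranaturality (x′ = Q(f)(x), y′ = Q(g)(y)).
module Submission where

open import Defs
open import Level using (_⊔_)
open import Data.Nat using (ℕ; zero; suc)
open import Data.Unit.Polymorphic using (tt)
open import Data.Product using (_,_; proj₁; proj₂)
open import Relation.Binary using (IsEquivalence; IsPartialOrder; Transitive)
open import Relation.Binary.PropositionalEquality as ≡
  using (_≡_; refl; cong; cong₂; subst; subst₂)
open import Relation.Binary.HeterogeneousEquality as ≅
  using (_≅_; ≅-to-≡; ≡-to-≅; ≡-subst-removable)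

Bijection-trans : ∀ {a b c ℓa ℓb ℓc} {A : Set a} {_≈A_ : A → A → Set ℓa}
                    {B : Set b} {_≈B_ : B → B → Set ℓb}
                    {C : Set c} {_≈C_ : C → C → Set ℓc} →
                  Transitive _≈A_ → Transitive _≈C_ →
                  Bijection A _≈A_ B _≈B_ → Bijection B _≈B_ C _≈C_ →
                  Bijection A _≈A_ C _≈C_
Bijection-trans transA transC AB BC = record
  { to        = λ x → BC.to (AB.to x)
  ; from      = λ z → AB.from (BC.from z)
  ; to-cong   = λ p → BC.to-cong (AB.to-cong p)
  ; from-cong = λ p → AB.from-cong (BC.from-cong p)
  ; to∘from   = λ z → transC (BC.to-cong (AB.to∘from (BC.from z))) (BC.to∘from z)
  ; from∘to   = λ x → transA (AB.from-cong (BC.from∘to (AB.to x))) (AB.from∘to x)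
  }
  where module AB = Bijection AB
        module BC = Bijection BC

pair-≅ : ∀ {a b} {A A′ : Set a} {B B′ : Set b} {x : A} {x′ : A′} {y : B} {y′ : B′} →
         x ≅ x′ → y ≅ y′ → (x , y) ≅ (x′ , y′)
pair-≅ ≅.refl ≅.refl = ≅.refl

module _ {o ℓ e o′ ℓ′ e′} {C : Category o ℓ e} {D : Category o′ ℓ′ e′} where
  private
    module D = Category D
    module DE {A B} = IsEquivalence (D.equiv {A} {B})

  subst₂-≈-trans : ∀ {U U′ U″ V V′ V″} (a : U ≡ U′) (a′ : U′ ≡ U″) (b : V ≡ V′) (b′ : V′ ≡ V″)
                     {f : U D.⇒ V} {g : U′ D.⇒ V′} {h : U″ D.⇒ V″} →
                   subst₂ D._⇒_ a b f D.≈ g → subst₂ D._⇒_ a′ b′ g D.≈ h →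
                   subst₂ D._⇒_ (≡.trans a a′) (≡.trans b b′) f D.≈ h
  subst₂-≈-trans refl refl refl refl = DE.trans

  StrictEq-trans : Transitive (StrictEq {C = C} {D = D})
  StrictEq-trans s t = record
    { eq₀ = λ A → ≡.trans (S.eq₀ A) (T.eq₀ A)
    ; eq₁ = λ {A} {B} f →
        subst₂-≈-trans (S.eq₀ A) (T.eq₀ A) (S.eq₀ B) (T.eq₀ B) (S.eq₁ f) (T.eq₁ f)
    }
    where module S = StrictEq s
          module T = StrictEq t

module _ {o ℓ e p r} {C : Category o ℓ e} (Q : Functor C (Pos p r)) where
  private
    module C = Category C
    module CE {A B} = IsEquivalence (C.equiv {A} {B})
    module ∫Q = Category (∫ C Q)

  subst-∫⇒ : ∀ {U U′ V V′ u v} (a : U ≡ U′) (b : V ≡ V′) (k : (U , u) ∫Q.⇒ (V , v)) →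
             Q≤ C Q (fun (F₁ Q (subst₂ C._⇒_ a b (proj₁ k))) (subst (Q₀ C Q) a u))
                    (subst (Q₀ C Q) b v)
  subst-∫⇒ refl refl k = proj₂ k

  Σ-subst : ∀ {X} (u : ∫Q.Obj) (p : proj₁ u ≡ X) → (X , subst (Q₀ C Q) p (proj₂ u)) ≡ u
  Σ-subst u refl = refl

  subst-proj₂-cong : ∀ {X} {u u′ : ∫Q.Obj} → u ≡ u′ → (p : proj₁ u ≡ X) (p′ : proj₁ u′ ≡ X) →
                     subst (Q₀ C Q) p (proj₂ u) ≡ subst (Q₀ C Q) p′ (proj₂ u′)
  subst-proj₂-cong refl refl refl = refl

  proj₁-subst₂-Σ-subst : ∀ {X Y} {u w : ∫Q.Obj} (p : proj₁ u ≡ X) (q : proj₁ w ≡ Y)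
                           (k : (X , subst (Q₀ C Q) p (proj₂ u))
                                ∫Q.⇒ (Y , subst (Q₀ C Q) q (proj₂ w)))
                           (l : u ∫Q.⇒ w) →
                         subst₂ C._⇒_ p q (proj₁ l) C.≈ proj₁ k →
                         proj₁ (subst₂ ∫Q._⇒_ (Σ-subst u p) (Σ-subst w q) k) C.≈ proj₁ l
  proj₁-subst₂-Σ-subst refl refl k l = CE.sym

  proj₁-subst₂-cong : ∀ {X Y x x′ y y′} (a : x ≡ x′) (b : y ≡ y′) (k : (X , x) ∫Q.⇒ (Y , y)) →
                      proj₁ (subst₂ ∫Q._⇒_ (cong (X ,_) a) (cong (Y ,_) b) k) ≡ proj₁ k
  proj₁-subst₂-cong refl refl k = refl

  Q≤-resp-≅ : ∀ {o′ ℓ′ e′} {D : Category o′ ℓ′ e′} (H : Functor D C)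
                {Z₁ Z₁′ Z₂ Z₂′ : Category.Obj D} → Z₁ ≡ Z₁′ → Z₂ ≡ Z₂′ →
                {k : Category._⇒_ D Z₁ Z₂} {k′ : Category._⇒_ D Z₁′ Z₂′} → k ≅ k′ →
                {u : Q₀ C Q (F₀ H Z₁)} {u′ : Q₀ C Q (F₀ H Z₁′)} → u ≅ u′ →
                {v : Q₀ C Q (F₀ H Z₂)} {v′ : Q₀ C Q (F₀ H Z₂′)} → v ≅ v′ →
              Q≤ C Q (fun (F₁ Q (F₁ H k)) u) v → Q≤ C Q (fun (F₁ Q (F₁ H k′)) u′) v′
  Q≤-resp-≅ H refl refl ≅.refl ≅.refl ≅.refl le = le

module LaxSections {o ℓ e p r} {C : Category o ℓ e} (Q : Functor C (Pos p r))
                   {o′ ℓ′ e′} {D : Category o′ ℓ′ e′} (G : Functor D C) where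
  private
    module C = Category C
    module CE {A B} = IsEquivalence (C.equiv {A} {B})
    module D = Category D

  record LaxSection : Set (o′ ⊔ ℓ′ ⊔ p ⊔ r) where
    field
      section : ∀ A → Q₀ C Q (F₀ G A)
      lax     : ∀ {A B} (h : A D.⇒ B) → Q≤ C Q (fun (F₁ Q (F₁ G h)) (section A)) (section B)

  open LaxSection

  SectionEq : LaxSection → LaxSection → Set (o′ ⊔ p)
  SectionEq s s′ = ∀ A → section s A ≡ section s′ A

  sectionOf : (F̄ : Functor D (∫ C Q)) → StrictEq (π C Q ∘F F̄) G → LaxSection
  sectionOf F̄ strict = record { section = sect ; lax = sect-lax }
    where
    open StrictEq strict
    sect : ∀ A → Q₀ C Q (F₀ G A)
    sect A = subst (Q₀ C Q) (eq₀ A) (proj₂ (F₀ F̄ A))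
    sect-lax : ∀ {A B} (h : A D.⇒ B) → Q≤ C Q (fun (F₁ Q (F₁ G h)) (sect A)) (sect B)
    sect-lax {A} {B} h = subst (λ z → Q≤ C Q z (sect B)) (F-resp-≈ Q (eq₁ h) (sect A))
                           (subst-∫⇒ Q (eq₀ A) (eq₀ B) (F₁ F̄ h))

  liftingOf : LaxSection → Functor D (∫ C Q)
  liftingOf s = record
    { F₀           = λ A → F₀ G A , section s A
    ; F₁           = λ h → F₁ G h , lax s h
    ; identity     = identity G
    ; homomorphism = homomorphism G
    ; F-resp-≈     = F-resp-≈ G
    }

  liftingOf-strict : ∀ s → StrictEq (π C Q ∘F liftingOf s) G
  liftingOf-strict s = record { eq₀ = λ _ → refl ; eq₁ = λ _ → CE.refl }

  sectionOf-liftingOf : ∀ s → SectionEq (sectionOf (liftingOf s) (liftingOf-strict s)) s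
  sectionOf-liftingOf s A = refl

  liftingOf-sectionOf : ∀ F̄ strict → StrictEq (liftingOf (sectionOf F̄ strict)) F̄
  liftingOf-sectionOf F̄ strict = record
    { eq₀ = λ A → Σ-subst Q (F₀ F̄ A) (eq₀ A)
    ; eq₁ = λ {A} {B} h → proj₁-subst₂-Σ-subst Q (eq₀ A) (eq₀ B)
                              (F₁ (liftingOf (sectionOf F̄ strict)) h) (F₁ F̄ h) (eq₁ h)
    }
    where open StrictEq strict

  sectionOf-cong : ∀ {F̄ F̄′ strict strict′} → StrictEq F̄ F̄′ →
                   SectionEq (sectionOf F̄ strict) (sectionOf F̄′ strict′)
  sectionOf-cong {strict = strict} {strict′} eq A =
    subst-proj₂-cong Q (StrictEq.eq₀ eq A) (StrictEq.eq₀ strict A) (StrictEq.eq₀ strict′ A)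

  liftingOf-cong : ∀ {s s′} → SectionEq s s′ → StrictEq (liftingOf s) (liftingOf s′)
  liftingOf-cong {s} eq = record
    { eq₀ = λ A → cong (F₀ G A ,_) (eq A)
    ; eq₁ = λ {A} {B} h → CE.reflexive (proj₁-subst₂-cong Q (eq A) (eq B) (F₁ (liftingOf s) h))
    }

module PowerFibres {o ℓ e p r} {C : Category o ℓ e} (Q : Functor C (Pos p r)) where
  private
    module QP X = IsPartialOrder (PosetObj.isPartialOrder (F₀ Q X))
    module C^ k = Category (Pow C k)
    module ∫^ k = Category (Pow (∫ C Q) k)

  π^ : (k : ℕ) → Functor (Pow (∫ C Q) k) (Pow C k)
  π^ = PowF (π C Q)

  pack : ∀ k (X : C^.Obj k) → QT C Q k X → ∫^.Obj k
  pack zero    _        _        = tt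
  pack (suc k) (X , Xs) (x , xs) = (X , x) , pack k Xs xs

  fibre : ∀ k (A : ∫^.Obj k) → QT C Q k (F₀ (π^ k) A)
  fibre zero    _              = tt
  fibre (suc k) ((X , x) , As) = x , fibre k As

  π-pack : ∀ k X x → F₀ (π^ k) (pack k X x) ≡ X
  π-pack zero    _        _        = refl
  π-pack (suc k) (X , Xs) (x , xs) = cong (X ,_) (π-pack k Xs xs)

  fibre-pack : ∀ k X x → fibre k (pack k X x) ≅ x
  fibre-pack zero    _        _        = ≅.refl
  fibre-pack (suc k) (X , Xs) (x , xs) = pair-≅ (≅.refl {x = x}) (fibre-pack k Xs xs)

  pack-fibre : ∀ k A → pack k (F₀ (π^ k) A) (fibre k A) ≡ A
  pack-fibre zero    _              = refl
  pack-fibre (suc k) ((X , x) , As) = cong ((X , x) ,_) (pack-fibre k As)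

  pack₁ : ∀ k {X X′} (f : C^._⇒_ k X X′) {x x′} →
          ≤T C Q k X′ (QT₁ C Q k f x) x′ → ∫^._⇒_ k (pack k X x) (pack k X′ x′)
  pack₁ zero    _        _        = tt
  pack₁ (suc k) (f , fs) (le , les) = (f , le) , pack₁ k fs les

  π-pack₁ : ∀ k {X X′} (f : C^._⇒_ k X X′) {x x′} (le : ≤T C Q k X′ (QT₁ C Q k f x) x′) →
            F₁ (π^ k) (pack₁ k f le) ≅ f
  π-pack₁ zero    _        _          = ≅.refl
  π-pack₁ (suc k) (f , fs) (le , les) = pair-≅ (≅.refl {x = f}) (π-pack₁ k fs les)

  fibre₁ : ∀ k {A B} (h : ∫^._⇒_ k A B) →
           ≤T C Q k (F₀ (π^ k) B) (QT₁ C Q k (F₁ (π^ k) h) (fibre k A)) (fibre k B)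
  fibre₁ zero    _                = tt
  fibre₁ (suc k) ((_ , le) , hs) = le , fibre₁ k hs

  ≤T-refl : ∀ k X x → ≤T C Q k X x x
  ≤T-refl zero    _        _        = tt
  ≤T-refl (suc k) (X , Xs) (x , xs) = QP.refl X , ≤T-refl k Xs xs

  QT₁-identity : ∀ k X x → QT₁ C Q k (C^.id k {X}) x ≡ x
  QT₁-identity zero    _        _        = refl
  QT₁-identity (suc k) (X , Xs) (x , xs) = cong₂ _,_ (identity Q x) (QT₁-identity k Xs xs)

module Extranaturality {o ℓ e p r} (C : Category o ℓ e) (Q : Functor C (Pos p r)) (n m : ℕ)
                       (F : Functor (Product (op (Pow C n)) (Pow C m)) C) where
  open PowerFibres Q
  private
    module QP X = IsPartialOrder (PosetObj.isPartialOrder (F₀ Q X))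
    module C^ k = Category (Pow C k)

  G : Functor (Product (op (Pow (∫ C Q) n)) (Pow (∫ C Q) m)) C
  G = F ∘F (opF (π^ n) ⁂ π^ m)

  open LaxSections Q G

  liftings≃sections : Bijection (Lifting C Q n m F) (LiftingEq C Q n m F) LaxSection SectionEq
  liftings≃sections = record
    { to        = λ L → sectionOf (Lifting.F̄ L) (Lifting.strict L)
    ; from      = λ s → record { F̄ = liftingOf s ; strict = liftingOf-strict s }
    ; to-cong   = λ {L} {L′} → sectionOf-cong {strict = Lifting.strict L} {Lifting.strict L′}
    ; from-cong = liftingOf-cong
    ; to∘from   = sectionOf-liftingOf
    ; from∘to   = λ L → liftingOf-sectionOf (Lifting.F̄ L) (Lifting.strict L)
    }

  Family : Set (o ⊔ p)
  Family = (X : C^.Obj n) (Y : C^.Obj m) → QT C Q n X → QT C Q m Y → Q₀ C Q (F₀ F (X , Y))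

  Family-cong-≅ : ∀ (ψ : Family) {X X′ Y Y′ x x′ y y′} → X ≡ X′ → Y ≡ Y′ → x ≅ x′ → y ≅ y′ →
                  ψ X Y x y ≅ ψ X′ Y′ x′ y′
  Family-cong-≅ ψ refl refl ≅.refl ≅.refl = ≅.refl

  LaxAlongArrows : Family → Set (o ⊔ ℓ ⊔ p ⊔ r)
  LaxAlongArrows ψ =
    ∀ {X X′ Y Y′} (f : C^._⇒_ n X X′) (g : C^._⇒_ m Y Y′) {x x′ y y′} →
    ≤T C Q n X′ (QT₁ C Q n f x) x′ → ≤T C Q m Y′ (QT₁ C Q m g y) y′ →
    Q≤ C Q (fun (F₁ Q (F₁ F {X′ , Y} {X , Y′} (f , g))) (ψ X′ Y x′ y)) (ψ X Y′ x y′)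

  laxAlongArrows : (φ : LaxExtranat C Q n m F) → LaxAlongArrows (LaxExtranat.ψ φ)
  laxAlongArrows φ {X} {X′} {Y} {Y′} f g {x} {x′} {y} {y′} le le′ =
    QP.trans (F₀ F (X , Y′))
      (mono (F₁ Q (F₁ F (f , g))) (φ.mono le (≤T-refl m Y y)))
      (QP.trans (F₀ F (X , Y′)) (φ.lax f g x y) (φ.mono (≤T-refl n X x) le′))
    where module φ = LaxExtranat φ

  laxExtranatOf : (ψ : Family) → LaxAlongArrows ψ → LaxExtranat C Q n m F
  laxExtranatOf ψ along = record
    { ψ    = ψ
    ; mono = λ {X} {Y} {x} {x′} {y} {y′} le le′ →
        subst (λ z → Q≤ C Q z (ψ X Y x′ y′))
          (≡.trans (F-resp-≈ Q (identity F) (ψ X Y x y)) (identity Q (ψ X Y x y)))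
          (along (C^.id n) (C^.id m)
             (subst (λ z → ≤T C Q n X z x) (≡.sym (QT₁-identity n X x′)) le)
             (subst (λ z → ≤T C Q m Y z y′) (≡.sym (QT₁-identity m Y y)) le′))
    ; lax  = λ {X} {X′} {Y} {Y′} f g x y →
        along f g (≤T-refl n X′ (QT₁ C Q n f x)) (≤T-refl m Y′ (QT₁ C Q m g y))
    }

  sectionOfExtranat : LaxExtranat C Q n m F → LaxSection
  sectionOfExtranat φ = record
    { section = λ (A , B) → LaxExtranat.ψ φ (F₀ (π^ n) A) (F₀ (π^ m) B) (fibre n A) (fibre m B)
    ; lax     = λ (h , k) → laxAlongArrows φ (F₁ (π^ n) h) (F₁ (π^ m) k) (fibre₁ n h) (fibre₁ m k)
    }

  familyOfSection : LaxSection → Family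
  familyOfSection s X Y x y =
    subst (Q₀ C Q) (cong₂ (λ X Y → F₀ F (X , Y)) (π-pack n X x) (π-pack m Y y))
      (LaxSection.section s (pack n X x , pack m Y y))

  familyOfSection-≅ : ∀ s X Y x y →
                      familyOfSection s X Y x y ≅ LaxSection.section s (pack n X x , pack m Y y)
  familyOfSection-≅ s X Y x y =
    ≡-subst-removable (Q₀ C Q) _ (LaxSection.section s (pack n X x , pack m Y y))

  familyOfSection-lax : ∀ s → LaxAlongArrows (familyOfSection s)
  familyOfSection-lax s {X} {X′} {Y} {Y′} f g {x} {x′} {y} {y′} le le′ =
    Q≤-resp-≅ Q F (cong₂ _,_ (π-pack n X′ x′) (π-pack m Y y))
                  (cong₂ _,_ (π-pack n X x) (π-pack m Y′ y′))
      (pair-≅ (π-pack₁ n f le) (π-pack₁ m g le′))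
      (≅.sym (familyOfSection-≅ s X′ Y x′ y)) (≅.sym (familyOfSection-≅ s X Y′ x y′))
      (LaxSection.lax s (pack₁ n f le , pack₁ m g le′))

  extranatOfSection : LaxSection → LaxExtranat C Q n m F
  extranatOfSection s = laxExtranatOf (familyOfSection s) (familyOfSection-lax s)

  sections≃extranats : Bijection LaxSection SectionEq (LaxExtranat C Q n m F) (LaxEq C Q n m F)
  sections≃extranats = record
    { to        = extranatOfSection
    ; from      = sectionOfExtranat
    ; to-cong   = λ eq X Y x y → cong (subst (Q₀ C Q) _) (eq (pack n X x , pack m Y y))
    ; from-cong = λ eq (A , B) → eq (F₀ (π^ n) A) (F₀ (π^ m) B) (fibre n A) (fibre m B)
    ; to∘from   = λ φ X Y x y → ≅-to-≡ (≅.trans (familyOfSection-≅ (sectionOfExtranat φ) X Y x y)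
        (Family-cong-≅ (LaxExtranat.ψ φ) (π-pack n X x) (π-pack m Y y)
                                        (fibre-pack n X x) (fibre-pack m Y y)))
    ; from∘to   = λ s (A , B) → ≅-to-≡ (≅.trans (familyOfSection-≅ s _ _ (fibre n A) (fibre m B))
        (≅.cong (LaxSection.section s) (≡-to-≅ (cong₂ _,_ (pack-fibre n A) (pack-fibre m B)))))
    }


mainTheorem1 : ∀ {o ℓ e p r} (C : Category o ℓ e) (Q : Functor C (Pos p r)) (n m : ℕ)
    (F : Functor (Product (op (Pow C n)) (Pow C m)) C) →
    Bijection (Lifting C Q n m F) (LiftingEq C Q n m F)
    (LaxExtranat C Q n m F) (LaxEq C Q n m F)
mainTheorem1 C Q n m F =
  Bijection-trans StrictEq-trans (λ eq eq′ X Y x y → ≡.trans (eq X Y x y) (eq′ X Y x y))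
    liftings≃sections sections≃extranats
  where open Extranaturality C Q n m F
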